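{- For every residuated lattice $\mathbf{A}$ the following are equivalent: (i) $\mathbf{A}$ satisfies $(\mathsf{1}\wedge(x\backslash y))\vee(\mathsf{1}\wedge(y\backslash x))\approx\mathsf{1}$ (left prelinearity); (ii) $\mathbf{A}$ satisfies $\mathsf{1}\wedge(x\vee y)\approx(\mathsf{1}\wedge x)\vee(\mathsf{1}\wedge y)$ and $(x\backslash y)\vee(y\backslash x)\geq\mathsf{1}$; (iii) the lattice reduct of $\mathbf{A}$ is distributive and $\mathbf{A}$ satisfies $(x\backslash y)\vee(y\backslash x)\geq\mathsf{1}$.
   Context: A residuated lattice is an algebra $\langle A; \wedge, \vee, \cdot, \mathsf{1}, \backslash, / \rangle$ such that $\langle A;\wedge,\vee\rangle$ is a lattice, $\langle A;\cdot,\mathsf{1}\rangle$ is a monoid, and $x \leq z/y \iff x\cdot y \leq z \iff y \leq x\backslash z$ for all $x,y,z$. -}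

module Defs where

open import Level using (Level; suc; _⊔_)
open import Data.Product using (_×_)
open import Relation.Binary.Core using (Rel)
open import Algebra.Core using (Op₂)
open import Algebra.Structures using (IsMonoid)
open import Algebra.Lattice.Structures using (IsLattice; IsDistributiveLattice)

record ResiduatedLattice (c ℓ : Level) : Set (suc (c ⊔ ℓ)) where
  infixr 7 _·_
  infixr 6 _∧_
  infixr 5 _∨_
  infix  4 _≈_ _≤_
  field
    Carrier   : Set c
    _≈_       : Rel Carrier ℓ
    _∧_       : Op₂ Carrier
    _∨_       : Op₂ Carrier
    _·_       : Op₂ Carrier
    1#        : Carrier
    _\\_      : Op₂ Carrier
    _//_      : Op₂ Carrier
    isLattice : IsLattice _≈_ _∨_ _∧_
    isMonoid  : IsMonoid _≈_ _·_ 1#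

  _≤_ : Rel Carrier ℓ
  x ≤ y = (x ∧ y) ≈ x

  field
    resid-/₁ : ∀ x y z → x ≤ (z // y) → (x · y) ≤ z
    resid-/₂ : ∀ x y z → (x · y) ≤ z → x ≤ (z // y)
    resid-\₁ : ∀ x y z → y ≤ (x \\ z) → (x · y) ≤ z
    resid-\₂ : ∀ x y z → (x · y) ≤ z → y ≤ (x \\ z)

module _ {c ℓ : Level} (A : ResiduatedLattice c ℓ) where
  open ResiduatedLattice A

  LeftPrelinear : Set (c ⊔ ℓ)
  LeftPrelinear = ∀ x y → ((1# ∧ (x \\ y)) ∨ (1# ∧ (y \\ x))) ≈ 1#

  OneMeetDistributes : Set (c ⊔ ℓ)
  OneMeetDistributes = ∀ x y → (1# ∧ (x ∨ y)) ≈ ((1# ∧ x) ∨ (1# ∧ y))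

  ResidualJoinAboveOne : Set (c ⊔ ℓ)
  ResidualJoinAboveOne = ∀ x y → 1# ≤ ((x \\ y) ∨ (y \\ x))

  DistributiveReduct : Set (c ⊔ ℓ)
  DistributiveReduct = IsDistributiveLattice _≈_ _∨_ _∧_

-- Write u = 1 ∧ (y \ x) and t = 1 ∧ (x \ y). Prelinearity says u ∨ t = 1, so every
-- element w satisfies w = w·(u ∨ t) ≤ w·u ∨ w·t. Both factors lie below 1, and u ≤ y \ x gives
-- y·u ≤ x, so w ≤ x ∨ y forces w·u ≤ w ∧ x and likewise w·t ≤ w ∧ y. Hence
-- w ∧ (x ∨ y) ≤ (w ∧ x) ∨ (w ∧ y): the lattice reduct is distributive, and w = 1 gives (ii).
module Submission where

open import Defs
open import Level using (Level)
open import Data.Product using (_×_; _,_; proj₁)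
open import Function.Bundles using (_⇔_; mk⇔)
open import Algebra.Lattice.Bundles using (Lattice)
open import Algebra.Lattice.Structures using (IsLattice; IsDistributiveLattice)
open import Algebra.Structures using (IsMonoid)
open import Relation.Binary.Structures using (IsEquivalence)
import Algebra.Lattice.Properties.Lattice as AlgebraicLattice
import Relation.Binary.Lattice as Order
import Relation.Binary.Lattice.Properties.DistributiveLattice as OrderDistributive
import Relation.Binary.Lattice.Properties.JoinSemilattice as OrderJoin
import Relation.Binary.Reasoning.PartialOrder as ≤-Reasoning

module _ {c ℓ : Level} (A : ResiduatedLattice c ℓ) where
  open ResiduatedLattice A
  open IsLattice isLattice using (isEquivalence; ∨-comm)
  open IsMonoid isMonoid using (identityʳ; ∙-cong)
  open IsEquivalence isEquivalence using () renaming (refl to ≈-refl; sym to ≈-sym; trans to ≈-trans)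

  lattice : Lattice c ℓ
  lattice = record { isLattice = isLattice }

  ≤-isLattice : Order.IsLattice _≈_ _≤_ _∨_ _∧_
  ≤-isLattice = record
    { isPartialOrder = record
      { isPreorder = record
        { isEquivalence = isEquivalence
        ; reflexive     = λ x≈y → ≈-sym (O.reflexive x≈y)
        ; trans         = λ x≤y y≤z → ≈-sym (O.trans (≈-sym x≤y) (≈-sym y≤z))
        }
      ; antisym = λ x≤y y≤x → O.antisym (≈-sym x≤y) (≈-sym y≤x)
      }
    ; supremum = λ x y → ≈-sym (O.x≤x∨y x y) , ≈-sym (O.y≤x∨y x y)
                       , λ z x≤z y≤z → ≈-sym (O.∨-least (≈-sym x≤z) (≈-sym y≤z))
    ; infimum  = λ x y → ≈-sym (O.x∧y≤x x y) , ≈-sym (O.x∧y≤y x y)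
                       , λ z z≤x z≤y → ≈-sym (O.∧-greatest (≈-sym z≤x) (≈-sym z≤y))
    }
    where
    -- the library orders an algebraic lattice by x ≈ x ∧ y, the converse of our x ∧ y ≈ x
    module O = Order.IsLattice (AlgebraicLattice.∨-∧-isOrderTheoreticLattice lattice)

  ≤-lattice : Order.Lattice c ℓ ℓ
  ≤-lattice = record { isLattice = ≤-isLattice }

  open Order.Lattice ≤-lattice
    using (refl; reflexive; trans; antisym; poset; x≤x∨y; y≤x∨y; ∨-least; x∧y≤x; x∧y≤y; ∧-greatest)
  open OrderJoin (Order.Lattice.joinSemilattice ≤-lattice) using (∨-monotonic)

  ∧-distribˡ-∨-≥ : ∀ x y z → (x ∧ y) ∨ (x ∧ z) ≤ x ∧ (y ∨ z)
  ∧-distribˡ-∨-≥ x y z = ∨-least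
    (∧-greatest (x∧y≤x x y) (trans (x∧y≤y x y) (x≤x∨y y z)))
    (∧-greatest (x∧y≤x x z) (trans (x∧y≤y x z) (y≤x∨y y z)))

  ·-monoʳ-≤ : ∀ x {y z} → y ≤ z → x · y ≤ x · z
  ·-monoʳ-≤ x {y} {z} y≤z = resid-\₁ x y (x · z) (trans y≤z (resid-\₂ x z (x · z) refl))

  ·-distribˡ-∨-≤ : ∀ x y z → x · (y ∨ z) ≤ (x · y) ∨ (x · z)
  ·-distribˡ-∨-≤ x y z = resid-\₁ x (y ∨ z) _
    (∨-least (resid-\₂ x y _ (x≤x∨y _ _)) (resid-\₂ x z _ (y≤x∨y _ _)))

  ·-decreasingʳ : ∀ x {y} → y ≤ 1# → x · y ≤ x
  ·-decreasingʳ x y≤1 = trans (·-monoʳ-≤ x y≤1) (reflexive (identityʳ x))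

  w·[1∧z\\y]≤y : ∀ {w} y z → w ≤ z ∨ y → w · (1# ∧ (z \\ y)) ≤ y
  w·[1∧z\\y]≤y {w} y z w≤z∨y = resid-/₁ w s y (trans w≤z∨y
    (∨-least (resid-/₂ z s y (resid-\₁ z s y (x∧y≤y 1# (z \\ y))))
             (resid-/₂ y s y (·-decreasingʳ y (x∧y≤x 1# (z \\ y))))))
    where s = 1# ∧ (z \\ y)

  prelinear⇒∧-distribˡ-∨-≤ : LeftPrelinear A → ∀ w y z → w ∧ (y ∨ z) ≤ (w ∧ y) ∨ (w ∧ z)
  prelinear⇒∧-distribˡ-∨-≤ prelinear w y z = begin
    v                   ≈⟨ ≈-sym (identityʳ v) ⟩
    v · 1#              ≈⟨ ∙-cong ≈-refl (≈-sym (prelinear z y)) ⟩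
    v · (s ∨ t)         ≤⟨ ·-distribˡ-∨-≤ v s t ⟩
    (v · s) ∨ (v · t)   ≤⟨ ∨-monotonic v·s≤w∧y v·t≤w∧z ⟩
    (w ∧ y) ∨ (w ∧ z)   ∎
    where
    open ≤-Reasoning poset
    v = w ∧ (y ∨ z)
    s = 1# ∧ (z \\ y)
    t = 1# ∧ (y \\ z)
    v≤w : v ≤ w
    v≤w = x∧y≤x w (y ∨ z)
    v·s≤w∧y : v · s ≤ w ∧ y
    v·s≤w∧y = ∧-greatest (trans (·-decreasingʳ v (x∧y≤x 1# (z \\ y))) v≤w)
      (w·[1∧z\\y]≤y y z (trans (x∧y≤y w (y ∨ z)) (reflexive (∨-comm y z))))
    v·t≤w∧z : v · t ≤ w ∧ z
    v·t≤w∧z = ∧-greatest (trans (·-decreasingʳ v (x∧y≤x 1# (y \\ z))) v≤w)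
      (w·[1∧z\\y]≤y z y (x∧y≤y w (y ∨ z)))

  prelinear⇒oneMeetDistributes : LeftPrelinear A → OneMeetDistributes A
  prelinear⇒oneMeetDistributes prelinear x y =
    antisym (prelinear⇒∧-distribˡ-∨-≤ prelinear 1# x y) (∧-distribˡ-∨-≥ 1# x y)

  prelinear⇒residualJoinAboveOne : LeftPrelinear A → ResidualJoinAboveOne A
  prelinear⇒residualJoinAboveOne prelinear x y = begin
    1#                                       ≈⟨ ≈-sym (prelinear x y) ⟩
    (1# ∧ (x \\ y)) ∨ (1# ∧ (y \\ x))        ≤⟨ ∨-monotonic (x∧y≤y 1# (x \\ y)) (x∧y≤y 1# (y \\ x)) ⟩
    (x \\ y) ∨ (y \\ x)                      ∎
    where open ≤-Reasoning poset

  -- 1 ≤ a unfolds to 1 ∧ a ≈ 1, so this is a single rewriting step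
  oneMeetDistributes⇒residualJoinAboveOne⇒prelinear :
    OneMeetDistributes A → ResidualJoinAboveOne A → LeftPrelinear A
  oneMeetDistributes⇒residualJoinAboveOne⇒prelinear distributes aboveOne x y =
    ≈-trans (≈-sym (distributes (x \\ y) (y \\ x))) (aboveOne x y)

  prelinear⇒distributiveReduct : LeftPrelinear A → DistributiveReduct A
  prelinear⇒distributiveReduct prelinear = record
    { isLattice   = isLattice
    ; ∨-distrib-∧ = D.∨-distrib-∧
    ; ∧-distrib-∨ = D.∧-distrib-∨
    }
    where
    ≤-distributiveLattice : Order.DistributiveLattice c ℓ ℓ
    ≤-distributiveLattice = record
      { isDistributiveLattice = record
        { isLattice    = ≤-isLattice
        ; ∧-distribˡ-∨ = λ w y z →
            antisym (prelinear⇒∧-distribˡ-∨-≤ prelinear w y z) (∧-distribˡ-∨-≥ w y z)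
        }
      }
    module D = OrderDistributive ≤-distributiveLattice

  distributiveReduct⇒oneMeetDistributes : DistributiveReduct A → OneMeetDistributes A
  distributiveReduct⇒oneMeetDistributes distributive =
    proj₁ (IsDistributiveLattice.∧-distrib-∨ distributive) 1#

corollary3p28 : {c ℓ : Level} (A : ResiduatedLattice c ℓ) →
    (LeftPrelinear A ⇔ (OneMeetDistributes A × ResidualJoinAboveOne A))
    × ((OneMeetDistributes A × ResidualJoinAboveOne A) ⇔ (DistributiveReduct A × ResidualJoinAboveOne A))
corollary3p28 A =
    mk⇔ (λ prelinear → prelinear⇒oneMeetDistributes A prelinear
                     , prelinear⇒residualJoinAboveOne A prelinear)
        (λ (distributes , aboveOne) →
           oneMeetDistributes⇒residualJoinAboveOne⇒prelinear A distributes aboveOne)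
  , mk⇔ (λ (distributes , aboveOne) →
           prelinear⇒distributiveReduct A
             (oneMeetDistributes⇒residualJoinAboveOne⇒prelinear A distributes aboveOne)
         , aboveOne)
        (λ (distributive , aboveOne) →
           distributiveReduct⇒oneMeetDistributes A distributive , aboveOne)
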